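{- Let $\pi$ be a permutation that contains the pattern $231$ or the pattern $4213$. Then $\pi$ cannot be sorted using a pop stack with bypass; that is, no sequence of the operations PUSH, POP and BYPASS applied to $\pi$ produces the identity permutation as output.
   Context: A permutation $\pi$ contains a pattern $\rho\in S_k$ if some subsequence of $\pi$ of length $k$ has entries in the same relative order as $\rho$; otherwise $\pi$ avoids $\rho$. A pop stack with bypass is a sorting device: the entries of the input permutation $\pi=\pi_1\cdots\pi_n$ are processed from left to right, and the allowed operations are PUSH (insert the current input entry on top of the pop stack), POP (remove all elements currently in the pop stack, appending them to the output from top to bottom), and BYPASS (append the current input entry directly to the output). After all entries are processed the pop stack is emptied into the output. $\pi$ can be sorted if some sequence of these operations yields the output $12\cdots n$. -}

module Defs where

open import Data.Nat using (ℕ; zero; suc; _<_)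
open import Data.List using (List; []; _∷_; _++_; length; lookup; map; upTo; reverse)
open import Data.List.Relation.Binary.Sublist.Propositional using (_⊆_)
open import Data.List.Relation.Binary.Permutation.Propositional using (_↭_)
open import Data.Maybe using (Maybe; just; nothing)
open import Data.Fin using (Fin; cast)
open import Data.Product using (Σ; ∃; _×_; _,_)
open import Relation.Binary.PropositionalEquality using (_≡_)
open import Function.Bundles using (_⇔_)

idPerm : ℕ → List ℕ
idPerm n = map suc (upTo n)

IsPerm : ℕ → List ℕ → Set
IsPerm n π = π ↭ idPerm n

SameOrder : (σ ρ : List ℕ) → length σ ≡ length ρ → Set
SameOrder σ ρ eq = ∀ (i j : Fin (length σ)) →
  (lookup σ i < lookup σ j) ⇔ (lookup ρ (cast eq i) < lookup ρ (cast eq j))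

Contains : List ℕ → List ℕ → Set
Contains π ρ = Σ (List ℕ) λ σ → σ ⊆ π × Σ (length σ ≡ length ρ) λ eq → SameOrder σ ρ eq

Avoids : List ℕ → List ℕ → Set
Avoids π ρ = Contains π ρ → Data.Empty.⊥
  where import Data.Empty

data Op : Set where
  PUSH POP BYPASS : Op

-- state: remaining input, pop stack (head = top), output so far
record State : Set where
  constructor st
  field
    input  : List ℕ
    stack  : List ℕ
    output : List ℕ

step : Op → State → Maybe State
step PUSH   (st []      s o) = nothing
step PUSH   (st (x ∷ i) s o) = just (st i (x ∷ s) o)
step BYPASS (st []      s o) = nothing
step BYPASS (st (x ∷ i) s o) = just (st i s (o ++ (x ∷ [])))
step POP    (st i       s o) = just (st i [] (o ++ s))

run : List Op → State → Maybe State
run []         σ = just σ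
run (op ∷ ops) σ with step op σ
... | nothing = nothing
... | just σ' = run ops σ'

outputOf : List ℕ → List Op → Maybe (List ℕ)
outputOf π ops with run ops (st π [] [])
... | nothing = nothing
... | just (st [] s o) = just (o ++ s)
... | just (st (_ ∷ _) s o) = nothing

Sortable : ℕ → List ℕ → Set
Sortable n π = ∃ λ (ops : List Op) → outputOf π ops ≡ just (idPerm n)

pat231 : List ℕ
pat231 = 2 ∷ 3 ∷ 1 ∷ []

pat4213 : List ℕ
pat4213 = 4 ∷ 2 ∷ 1 ∷ 3 ∷ []

module Submission where

-- The output of a pop stack with bypass, followed by the current contents of
-- the pop stack, is never reordered by later operations, and every entry
-- still to be read lands after everything already output.  Restricting a
-- sorting run of π to the entries of a subsequence gives a sorting run of the
-- subsequence, so it suffices to check that the patterns 231 and 4213 cannot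
-- be sorted, and these two invariants refute every branch of that search
-- after at most three operations.

open import Defs
open import Data.Nat using (ℕ; _<_; z<s; s<s; _≟_)
open import Data.Nat.Properties using (<-asym; <-trans; suc-injective)
open import Data.List using (List; []; _∷_; _++_; filter)
open import Data.List.Properties using (filter-accept; filter-reject; filter-++; ++-identityʳ)
open import Data.List.Membership.Propositional using (_∈_)
open import Data.List.Membership.Propositional.Properties using (∈-++⁺ʳ)
open import Data.List.Membership.DecPropositional _≟_ using (_∈?_)
open import Data.List.Relation.Unary.All using ([]; _∷_)
open import Data.List.Relation.Unary.Any using (here; there)
open import Data.List.Relation.Unary.AllPairs using (AllPairs; []; _∷_)
import Data.List.Relation.Unary.AllPairs.Properties as AllPairs
open import Data.List.Relation.Unary.Unique.Propositional using (Unique)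
open import Data.List.Relation.Unary.Unique.Propositional.Properties using (Unique[x∷xs]⇒x∉xs)
import Data.List.Relation.Unary.Unique.Propositional.Properties as Unique
open import Data.List.Relation.Binary.Sublist.Propositional
  using (_⊆_; []; _∷_; _∷ʳ_; ⊆-refl; ⊆-trans; from∈)
open import Data.List.Relation.Binary.Sublist.Propositional.Properties
  using (All-resp-⊆; Any-resp-⊆; ++⁺; ++⁺ˡ; ++⁺ʳ)
open import Data.List.Relation.Binary.Permutation.Propositional using (↭-sym; ↭⇒↭ₛ)
open import Relation.Binary.PropositionalEquality using (setoid)
open import Data.List.Relation.Binary.Permutation.Setoid.Properties
  (setoid ℕ) using (Unique-resp-↭)
open import Data.Maybe using (just)
open import Data.Product using (∃; ∃₂; _×_; _,_)
open import Data.Sum using (_⊎_; inj₁; inj₂)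
open import Data.Fin using (#_)
open import Function using (_∘_; id)
open import Function.Bundles using (Equivalence)
open import Data.Empty using (⊥-elim)
open import Relation.Nullary using (¬_; yes; no)
open import Relation.Unary using (Pred; Decidable)
open import Relation.Binary.PropositionalEquality using (_≡_; refl; sym; trans; cong; subst)

Increasing : List ℕ → Set
Increasing = AllPairs _<_

AllPairs-resp-⊇ : ∀ {A : Set} {R : A → A → Set} {xs ys : List A} → xs ⊆ ys → AllPairs R ys → AllPairs R xs
AllPairs-resp-⊇ []         []       = []
AllPairs-resp-⊇ (y ∷ʳ p)   (_ ∷ r)  = AllPairs-resp-⊇ p r
AllPairs-resp-⊇ (refl ∷ p) (a ∷ r)  = All-resp-⊆ p a ∷ AllPairs-resp-⊇ p r

descent⇒¬increasing : ∀ {x y zs} → y < x → x ∷ y ∷ [] ⊆ zs → ¬ Increasing zs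
descent⇒¬increasing y<x sub inc with AllPairs-resp-⊇ sub inc
... | (x<y ∷ []) ∷ _ = <-asym x<y y<x

run-∷ : ∀ op ops {σ τ} → step op σ ≡ just τ → run (op ∷ ops) σ ≡ run ops τ
run-∷ op ops e rewrite e = refl

-- The pop stack will be emptied into the output as it stands, so these
-- entries are already in their final relative order.
commit : State → List ℕ
commit (st _ s o) = o ++ s

step-commit-⊆ : ∀ op {σ τ} → step op σ ≡ just τ → commit σ ⊆ commit τ
step-commit-⊆ PUSH   {st (x ∷ _) s o} refl = ++⁺ (⊆-refl {x = o}) (x ∷ʳ ⊆-refl)
step-commit-⊆ BYPASS {st (x ∷ _) s o} refl = ++⁺ (++⁺ʳ (x ∷ []) (⊆-refl {x = o})) ⊆-refl
step-commit-⊆ POP    {st _ s o}       refl = ++⁺ʳ [] (⊆-refl {x = o ++ s})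

run-commit-⊆ : ∀ ops {σ τ} → run ops σ ≡ just τ → commit σ ⊆ commit τ
run-commit-⊆ []         refl = ⊆-refl
run-commit-⊆ (op ∷ ops) {σ} eq with step op σ in e
... | just σ′ = ⊆-trans (step-commit-⊆ op e) (run-commit-⊆ ops eq)

-- PUSH and BYPASS both insert the new entry right after the current output.
step-pending : ∀ op {σ τ y} → step op σ ≡ just τ → y ∈ State.input σ →
  State.output σ ++ y ∷ [] ⊆ commit τ ⊎ (y ∈ State.input τ × State.output σ ⊆ State.output τ)
step-pending PUSH   {st (x ∷ _) s o} refl (here refl) = inj₁ (++⁺ (⊆-refl {x = o}) (refl ∷ ++⁺ʳ s []))
step-pending PUSH   {st (x ∷ _) s o} refl (there y∈) = inj₂ (y∈ , ⊆-refl)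
step-pending BYPASS {st (x ∷ _) s o} refl (here refl) = inj₁ (++⁺ʳ s ⊆-refl)
step-pending BYPASS {st (x ∷ _) s o} refl (there y∈) = inj₂ (y∈ , ++⁺ʳ (x ∷ []) ⊆-refl)
step-pending POP    {st _ s o}       refl y∈          = inj₂ (y∈ , ++⁺ʳ s ⊆-refl)

run-pending : ∀ ops {σ s o y} → run ops σ ≡ just (st [] s o) → y ∈ State.input σ →
  State.output σ ++ y ∷ [] ⊆ o ++ s
run-pending []         refl ()
run-pending (op ∷ ops) {σ} eq y∈ with step op σ in e
... | just σ′ with step-pending op e y∈
...   | inj₁ sub          = ⊆-trans sub (run-commit-⊆ ops eq)
...   | inj₂ (y∈′ , out⊆) = ⊆-trans (++⁺ out⊆ ⊆-refl) (run-pending ops eq y∈′)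

Hopeless : State → Set
Hopeless σ = ∀ ops {s o} → run ops σ ≡ just (st [] s o) → ¬ Increasing (o ++ s)

committed-descent⇒hopeless : ∀ {σ x y} → y < x → x ∷ y ∷ [] ⊆ commit σ → Hopeless σ
committed-descent⇒hopeless y<x sub ops eq =
  descent⇒¬increasing y<x (⊆-trans sub (run-commit-⊆ ops eq))

output-above-pending⇒hopeless : ∀ {σ x y} → y < x →
  x ∈ State.output σ → y ∈ State.input σ → Hopeless σ
output-above-pending⇒hopeless y<x x∈ y∈ ops eq =
  descent⇒¬increasing y<x (⊆-trans (++⁺ (from∈ x∈) ⊆-refl) (run-pending ops eq y∈))

next-between-stacked⇒hopeless : ∀ {b c d i s o} → b < c → c < d → b ∈ s → d ∈ s →
  Hopeless (st (c ∷ i) s o)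
next-between-stacked⇒hopeless b<c c<d b∈ d∈ (POP ∷ ops) =
  output-above-pending⇒hopeless c<d (∈-++⁺ʳ _ d∈) (here refl) ops
next-between-stacked⇒hopeless {o = o} b<c c<d b∈ d∈ (PUSH ∷ ops) =
  committed-descent⇒hopeless b<c (++⁺ˡ o (refl ∷ from∈ b∈)) ops
next-between-stacked⇒hopeless {c = c} {o = o} b<c c<d b∈ d∈ (BYPASS ∷ ops) =
  committed-descent⇒hopeless b<c (++⁺ (++⁺ˡ o (⊆-refl {x = c ∷ []})) (from∈ b∈)) ops

module _ {a b c : ℕ} (a<b : a < b) (b<c : b < c) where

  hopeless-231 : Hopeless (st (b ∷ c ∷ a ∷ []) [] [])
  hopeless-231 (POP ∷ ops) = hopeless-231 ops
  hopeless-231 (BYPASS ∷ ops) =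
    output-above-pending⇒hopeless a<b (here refl) (there (here refl)) ops
  hopeless-231 (PUSH ∷ POP ∷ ops) =
    output-above-pending⇒hopeless a<b (here refl) (there (here refl)) ops
  hopeless-231 (PUSH ∷ BYPASS ∷ ops) =
    output-above-pending⇒hopeless (<-trans a<b b<c) (here refl) (here refl) ops
  hopeless-231 (PUSH ∷ PUSH ∷ ops) =
    committed-descent⇒hopeless b<c ⊆-refl ops

module _ {a b c d : ℕ} (a<b : a < b) (b<c : b < c) (c<d : c < d) where

  private
    a<d : a < d
    a<d = <-trans a<b (<-trans b<c c<d)

  hopeless-4213 : Hopeless (st (d ∷ b ∷ a ∷ c ∷ []) [] [])
  hopeless-4213 (POP ∷ ops) = hopeless-4213 ops
  hopeless-4213 (BYPASS ∷ ops) =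
    output-above-pending⇒hopeless a<d (here refl) (there (here refl)) ops
  hopeless-4213 (PUSH ∷ POP ∷ ops) =
    output-above-pending⇒hopeless a<d (here refl) (there (here refl)) ops
  hopeless-4213 (PUSH ∷ BYPASS ∷ ops) =
    output-above-pending⇒hopeless a<b (here refl) (here refl) ops
  hopeless-4213 (PUSH ∷ PUSH ∷ POP ∷ ops) =
    output-above-pending⇒hopeless a<b (here refl) (here refl) ops
  hopeless-4213 (PUSH ∷ PUSH ∷ BYPASS ∷ ops) =
    next-between-stacked⇒hopeless b<c c<d (here refl) (there (here refl)) ops
  hopeless-4213 (PUSH ∷ PUSH ∷ PUSH ∷ ops) =
    next-between-stacked⇒hopeless b<c c<d (there (here refl)) (there (there (here refl))) ops

module Restriction {p} {P : Pred ℕ p} (P? : Decidable P) where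

  restrict : State → State
  restrict (st i s o) = st (filter P? i) (filter P? s) (filter P? o)

  step-restrict : ∀ op {σ τ} → step op σ ≡ just τ →
    restrict σ ≡ restrict τ ⊎ step op (restrict σ) ≡ just (restrict τ)
  step-restrict PUSH {st (x ∷ i) s o} refl with P? x
  ... | yes _ = inj₂ refl
  ... | no _  = inj₁ refl
  step-restrict BYPASS {st (x ∷ i) s o} refl rewrite filter-++ P? o (x ∷ []) with P? x
  ... | yes _ = inj₂ refl
  ... | no _  = inj₁ (cong (st _ _) (sym (++-identityʳ (filter P? o))))
  step-restrict POP {st i s o} refl rewrite filter-++ P? o s = inj₂ refl

  run-restrict : ∀ ops {σ τ} → run ops σ ≡ just τ → ∃ λ ops′ → run ops′ (restrict σ) ≡ just (restrict τ)
  run-restrict []         refl = [] , refl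
  run-restrict (op ∷ ops) {σ} eq with step op σ in e
  ... | just σ′ with run-restrict ops eq | step-restrict op e
  ...   | ops′ , r | inj₁ same = ops′ , trans (cong (run ops′) same) r
  ...   | ops′ , r | inj₂ e′   = op ∷ ops′ , trans (run-∷ op ops′ e′) r

  filter-exact : ∀ {xs ys} → Unique ys → xs ⊆ ys →
    (∀ {z} → z ∈ xs → P z) → (∀ {z} → z ∈ ys → P z → z ∈ xs) → filter P? ys ≡ xs
  filter-exact _          []           _    _     = refl
  filter-exact u@(_ ∷ u′) (y ∷ʳ sub)   allP onlyP =
    trans (filter-reject P? (λ py → Unique[x∷xs]⇒x∉xs u (Any-resp-⊆ sub (onlyP (here refl) py))))
          (filter-exact u′ sub allP (onlyP ∘ there))
  filter-exact u@(_ ∷ u′) (refl ∷ sub) allP onlyP =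
    trans (filter-accept P? (allP (here refl)))
          (cong (_ ∷_) (filter-exact u′ sub (allP ∘ there) onlyP′))
    where
      onlyP′ : ∀ {z} → z ∈ _ → P z → z ∈ _
      onlyP′ z∈ pz with onlyP (there z∈) pz
      ... | here refl = ⊥-elim (Unique[x∷xs]⇒x∉xs u z∈)
      ... | there z∈′ = z∈′

idPerm-increasing : ∀ n → Increasing (idPerm n)
idPerm-increasing n = AllPairs.map⁺ (AllPairs.applyUpTo⁺₁ id n (λ i<j _ → s<s i<j))

perm-unique : ∀ {n π} → IsPerm n π → Unique π
perm-unique {n} p = Unique-resp-↭ (↭⇒↭ₛ (↭-sym p)) (Unique.map⁺ suc-injective (Unique.upTo⁺ n))

outputOf-run : ∀ π ops {L} → outputOf π ops ≡ just L →
  ∃₂ λ s o → run ops (st π [] []) ≡ just (st [] s o) × o ++ s ≡ L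
outputOf-run π ops eq with run ops (st π [] [])
outputOf-run π ops refl | just (st [] s o) = s , o , refl , refl

sortable⇒subsequence-not-hopeless : ∀ {n π σ} → IsPerm n π → σ ⊆ π → Sortable n π →
  ¬ Hopeless (st σ [] [])
sortable⇒subsequence-not-hopeless {n} {π} {σ} perm sub (ops , out) hopeless
  with outputOf-run π ops out
... | s , o , r , sorted with Restriction.run-restrict (_∈? σ) ops r
... | ops′ , r′ = hopeless ops′ (subst start (filter-exact (perm-unique perm) sub id (λ _ → id)) r′) increasing
  where
    open Restriction (_∈? σ)
    start : List ℕ → Set
    start i = run ops′ (st i [] []) ≡ just (restrict (st [] s o))
    increasing : Increasing (filter (_∈? σ) o ++ filter (_∈? σ) s)
    increasing = subst Increasing (filter-++ (_∈? σ) o s)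
                   (AllPairs.filter⁺ (_∈? σ) (subst Increasing (sym sorted) (idPerm-increasing n)))

contains231⇒subsequence : ∀ {π} → Contains π pat231 →
  ∃₂ λ a b → ∃ λ c → a < b × b < c × b ∷ c ∷ a ∷ [] ⊆ π
contains231⇒subsequence ([] , _ , () , _)
contains231⇒subsequence (_ ∷ [] , _ , () , _)
contains231⇒subsequence (_ ∷ _ ∷ [] , _ , () , _)
contains231⇒subsequence (_ ∷ _ ∷ _ ∷ _ ∷ _ , _ , () , _)
contains231⇒subsequence (x ∷ y ∷ z ∷ [] , sub , _ , order) =
  z , x , y , Equivalence.from (order (# 2) (# 0)) (s<s z<s)
            , Equivalence.from (order (# 0) (# 1)) (s<s (s<s z<s)) , sub

contains4213⇒subsequence : ∀ {π} → Contains π pat4213 →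
  ∃₂ λ a b → ∃₂ λ c d → a < b × b < c × c < d × d ∷ b ∷ a ∷ c ∷ [] ⊆ π
contains4213⇒subsequence ([] , _ , () , _)
contains4213⇒subsequence (_ ∷ [] , _ , () , _)
contains4213⇒subsequence (_ ∷ _ ∷ [] , _ , () , _)
contains4213⇒subsequence (_ ∷ _ ∷ _ ∷ [] , _ , () , _)
contains4213⇒subsequence (_ ∷ _ ∷ _ ∷ _ ∷ _ ∷ _ , _ , () , _)
contains4213⇒subsequence (x ∷ y ∷ z ∷ w ∷ [] , sub , _ , order) =
  z , y , w , x , Equivalence.from (order (# 2) (# 1)) (s<s z<s)
                , Equivalence.from (order (# 1) (# 3)) (s<s (s<s z<s))
                , Equivalence.from (order (# 3) (# 0)) (s<s (s<s (s<s z<s))) , sub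

mainTheorem1 : (n : ℕ) (π : List ℕ) → IsPerm n π →
    Contains π pat231 ⊎ Contains π pat4213 → ¬ Sortable n π
mainTheorem1 n π perm (inj₁ occ) sortable with contains231⇒subsequence occ
... | _ , _ , _ , a<b , b<c , sub =
  sortable⇒subsequence-not-hopeless perm sub sortable (hopeless-231 a<b b<c)
mainTheorem1 n π perm (inj₂ occ) sortable with contains4213⇒subsequence occ
... | _ , _ , _ , _ , a<b , b<c , c<d , sub =
  sortable⇒subsequence-not-hopeless perm sub sortable (hopeless-4213 a<b b<c c<d)
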